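{- For positive integers $k,s$, $\mu(k,s)\leq k\cdot(\mu(k,s,(k-1))-1)+1$. Similarly, for positive integers $k,p,q$, $\mu(k,p,q)\leq k\cdot(\mu(k,p,q,(k-1))-1)+1$.
   Context: A literal is a propositional variable $x$ or its negation $\overline{x}$; a clause is a finite set of literals not containing both a literal and its negation; a CNF formula is a finite set of clauses. A $(k,s)$-formula is a CNF formula in which every clause contains exactly $k$ distinct literals and every variable occurs in at most $s$ clauses; a $(\leq k,s)$-formula is the same with every clause containing at most $k$ literals. A $(k,p,q)$-formula is a CNF formula in which every clause contains exactly $k$ distinct literals and every variable occurs positively in at most $p$ clauses and negatively in at most $q$ clauses; a $(\leq k,p,q)$-formula is the same with every clause containing at most $k$ literals. A stairway is a finite non-increasing sequence $\sigma=(a_1,\dots,a_r)$ of positive integers; for fixed $k$, a formula $F$ has stairway $\sigma$ if its clauses can be enumerated as $C_1,\dots,C_m$ with $|C_i|=k-a_i$ for $i\leq r$ and $|C_i|=k$ for $i>r$. Thus stairway $(k-1)$ means exactly one clause has one literal and all others have $k$ literals. $\mu(k,s)$ and $\mu(k,p,q)$ are the numbers of clauses of smallest unsatisfiable $(k,s)$- resp. $(k,p,q)$-formulas; $\mu(k,s,\sigma)$ and $\mu(k,p,q,\sigma)$ are the numbers of clauses of smallest unsatisfiable $(\leq k,s)$- resp. $(\leq k,p,q)$-formulas with stairway $\sigma$ (each $\infty$ if none exists). -}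

module Defs where

open import Data.Nat using (ℕ; _≤_; _∸_; _+_; _*_)
import Data.Nat as ℕ
open import Data.Bool using (Bool; true; false)
import Data.Bool as 𝔹
open import Data.Product using (_×_; _,_; proj₁; proj₂; ∃; ∃-syntax)
open import Data.Product.Properties using (≡-dec)
open import Data.List using (List; []; _∷_; length; filter)
open import Data.List.Relation.Unary.All using (All)
open import Data.List.Relation.Unary.Any using (Any)
open import Data.List.Relation.Unary.AllPairs using (AllPairs)
open import Data.List.Relation.Unary.Unique.Propositional using (Unique)
open import Data.List.Relation.Binary.Permutation.Propositional using (_↭_)
open import Relation.Binary.PropositionalEquality using (_≡_)
open import Relation.Binary.Definitions using (DecidableEquality)
open import Relation.Nullary using (¬_)
open import Relation.Nullary.Decidable using (_⊎-dec_)

-- A literal is a pair (variable , polarity); polarity true = positive x, false = negated x̄.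
Lit : Set
Lit = ℕ × Bool

_≟ᴸ_ : DecidableEquality Lit
_≟ᴸ_ = ≡-dec ℕ._≟_ 𝔹._≟_

open import Data.List.Membership.DecPropositional _≟ᴸ_ using (_∈_; _∈?_)
open import Data.List.Relation.Binary.Subset.Propositional using (_⊆_)

Clause : Set
Clause = List Lit

-- A CNF formula: a finite list of clauses (well-formedness below makes it a set).
Formula : Set
Formula = List Clause

WFClause : Clause → Set
WFClause C = Unique C × (∀ x → ¬ ((x , true) ∈ C × (x , false) ∈ C))

WFFormula : Formula → Set
WFFormula F = All WFClause F × AllPairs (λ C D → ¬ (C ⊆ D × D ⊆ C)) F

SatLit : (ℕ → Bool) → Lit → Set
SatLit α l = α (proj₁ l) ≡ proj₂ l

SatClause : (ℕ → Bool) → Clause → Set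
SatClause α C = Any (SatLit α) C

Satisfiable : Formula → Set
Satisfiable F = ∃[ α ] All (SatClause α) F

Unsatisfiable : Formula → Set
Unsatisfiable F = ¬ Satisfiable F

posOcc : ℕ → Formula → ℕ
posOcc x F = length (filter (λ C → (x , true) ∈? C) F)

negOcc : ℕ → Formula → ℕ
negOcc x F = length (filter (λ C → (x , false) ∈? C) F)

occ : ℕ → Formula → ℕ
occ x F = length (filter (λ C → ((x , true) ∈? C) ⊎-dec ((x , false) ∈? C)) F)

IsKS : ℕ → ℕ → Formula → Set
IsKS k s F = WFFormula F × All (λ C → length C ≡ k) F × (∀ x → occ x F ≤ s)

IsKPQ : ℕ → ℕ → ℕ → Formula → Set
IsKPQ k p q F =
  WFFormula F × All (λ C → length C ≡ k) F
  × (∀ x → posOcc x F ≤ p) × (∀ x → negOcc x F ≤ q)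

-- Stairway (k-1): the clauses can be enumerated C₁, C₂, …, Cₘ with |C₁| = k-(k-1) = 1
-- and |Cᵢ| = k for i > 1.
HasStairwayKm1 : ℕ → Formula → Set
HasStairwayKm1 k F =
  ∃[ C ] ∃[ rest ] (F ↭ (C ∷ rest)) × length C ≡ k ∸ (k ∸ 1) × All (λ D → length D ≡ k) rest

IsKS-Stair : ℕ → ℕ → Formula → Set
IsKS-Stair k s F =
  WFFormula F × All (λ C → length C ≤ k) F × (∀ x → occ x F ≤ s) × HasStairwayKm1 k F

IsKPQ-Stair : ℕ → ℕ → ℕ → Formula → Set
IsKPQ-Stair k p q F =
  WFFormula F × All (λ C → length C ≤ k) F
  × (∀ x → posOcc x F ≤ p) × (∀ x → negOcc x F ≤ q) × HasStairwayKm1 k F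

-- Write F = {l} ∪ R with all clauses of R of size k. Take k copies of R on pairwise
-- disjoint sets of variables (variable y of copy i becomes i + y·k) and add the single
-- k-clause formed by the k copies of l. An assignment satisfying this formula satisfies
-- some copy of l, and read back through that copy it satisfies F, so the new formula is
-- unsatisfiable. Each of its variables occurs exactly as often, with the same signs, as
-- the variable of F it copies, and it has k·|R| + 1 = k·(|F| − 1) + 1 clauses.
module Submission where

open import Defs
open import Data.Nat using (ℕ; _≤_; _∸_; _+_; _*_)
open import Data.Product using (_×_; ∃-syntax)
open import Data.List using (length)

open import Level using (0ℓ)
open import Function using (_∘_)
open import Function.Definitions using (Injective)
open import Data.Nat using (suc; zero; _<_; s≤s; z≤n; NonZero; _%_; _/_)
open import Data.Nat.Properties
open import Data.Nat.DivMod using ([m+kn]%n≡m%n; m<n⇒m%n≡m; +-distrib-/; m<n⇒m/n≡0; m*n/n≡m; m*n%n≡0)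
open import Data.Bool using (true; false)
open import Data.Product using (_,_; proj₁; proj₂)
open import Data.Sum using (_⊎_; inj₁; inj₂)
open import Data.List using (List; []; _∷_; [_]; _++_; map; filter; upTo)
open import Data.List.Properties using (length-map; length-++; filter-++; filter-none; length-upTo)
open import Data.List.Relation.Unary.All as All using (All; []; _∷_)
import Data.List.Relation.Unary.All.Properties as All
open import Data.List.Relation.Unary.Any using (here)
import Data.List.Relation.Unary.Any.Properties as Any
open import Data.List.Relation.Unary.AllPairs as AllPairs using (AllPairs; []; _∷_)
import Data.List.Relation.Unary.AllPairs.Properties as AllPairsₚ
import Data.List.Relation.Unary.Unique.Propositional.Properties as Unique
open import Data.List.Membership.Propositional using (_∈_; find)
open import Data.List.Membership.Propositional.Properties using (∈-map⁺; ∈-map⁻; ∈-upTo⁺; ∈-upTo⁻)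
open import Data.List.Membership.DecPropositional _≟ᴸ_ using (_∈?_)
open import Data.List.Relation.Binary.Permutation.Propositional using (_↭_; ↭-sym; ↭⇒↭ₛ)
open import Data.List.Relation.Binary.Permutation.Propositional.Properties using (All-resp-↭; ↭-length; filter-↭)
import Data.List.Relation.Binary.Permutation.Setoid.Properties as Permutationₛ
open import Data.List.Relation.Binary.Subset.Propositional using (_⊆_)
open import Relation.Binary.PropositionalEquality using (_≡_; refl; sym; trans; cong; cong₂; subst; resp₂; setoid; module ≡-Reasoning)
open import Relation.Nullary using (¬_; yes; no; contradiction)
open import Relation.Nullary.Decidable using (_⊎-dec_)
open import Relation.Unary using (Pred; Decidable; ∁)

count : {A : Set} {P : Pred A 0ℓ} → Decidable P → List A → ℕ
count P? = length ∘ filter P?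

module _ {A : Set} {P : Pred A 0ℓ} (P? : Decidable P) where

  count-++ : ∀ xs ys → count P? (xs ++ ys) ≡ count P? xs + count P? ys
  count-++ xs ys = trans (cong length (filter-++ P? xs ys)) (length-++ (filter P? xs))

  count-↭ : ∀ {xs ys} → xs ↭ ys → count P? xs ≡ count P? ys
  count-↭ xs↭ys = ↭-length (filter-↭ P? xs↭ys)

  count-none : ∀ {xs} → All (∁ P) xs → count P? xs ≡ 0
  count-none = cong length ∘ filter-none P?

module _ {A B : Set} {P : Pred A 0ℓ} {Q : Pred B 0ℓ} (P? : Decidable P) (Q? : Decidable Q) where

  count-∷-mono : ∀ {x y xs ys} → (P x → Q y) → count P? xs ≤ count Q? ys →
                 count P? (x ∷ xs) ≤ count Q? (y ∷ ys)
  count-∷-mono {x} {y} Px⇒Qy le with P? x | Q? y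
  ... | yes Px | yes _  = s≤s le
  ... | yes Px | no ¬Qy = contradiction (Px⇒Qy Px) ¬Qy
  ... | no _   | yes _  = m≤n⇒m≤1+n le
  ... | no _   | no _   = le

  count-map-mono : (f : B → A) → (∀ y → P (f y) → Q y) → ∀ ys → count P? (map f ys) ≤ count Q? ys
  count-map-mono f Pf⇒Q []       = z≤n
  count-map-mono f Pf⇒Q (y ∷ ys) = count-∷-mono (Pf⇒Q y) (count-map-mono f Pf⇒Q ys)

length≡suc⇒∃∈ : ∀ {A : Set} {xs : List A} {m} → length xs ≡ suc m → ∃[ a ] a ∈ xs
length≡suc⇒∃∈ {xs = a ∷ _} _ = a , here refl

Distinct : Clause → Clause → Set
Distinct C D = ¬ (C ⊆ D × D ⊆ C)

Distinct-sym : ∀ {C D} → Distinct C D → Distinct D C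
Distinct-sym C≉D (D⊆C , C⊆D) = C≉D (C⊆D , D⊆C)

WFFormula-resp-↭ : ∀ {F F′} → F ↭ F′ → WFFormula F → WFFormula F′
WFFormula-resp-↭ F↭F′ (wfClauses , distinct) =
  All-resp-↭ F↭F′ wfClauses ,
  Permutationₛ.AllPairs-resp-↭ (setoid Clause) Distinct-sym (resp₂ Distinct) (↭⇒↭ₛ F↭F′) distinct

Unsatisfiable-resp-↭ : ∀ {F F′} → F ↭ F′ → Unsatisfiable F → Unsatisfiable F′
Unsatisfiable-resp-↭ F↭F′ unsat (α , sat) = unsat (α , All-resp-↭ (↭-sym F↭F′) sat)

OccurrenceBounded : Formula → Formula → Set
OccurrenceBounded G F =
  ∀ x → ∃[ y ] occ x G ≤ occ y F × posOcc x G ≤ posOcc y F × negOcc x G ≤ negOcc y F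

OccurrenceBounded-resp-↭ : ∀ {G F F′} → F ↭ F′ → OccurrenceBounded G F → OccurrenceBounded G F′
OccurrenceBounded-resp-↭ F↭F′ bounded x =
  let y , occ≤ , pos≤ , neg≤ = bounded x
  in y , ≤-trans occ≤ (≤-reflexive (count-↭ _ F↭F′))
       , ≤-trans pos≤ (≤-reflexive (count-↭ _ F↭F′))
       , ≤-trans neg≤ (≤-reflexive (count-↭ _ F↭F′))

renameLit : (ℕ → ℕ) → Lit → Lit
renameLit f (x , b) = f x , b

rename : (ℕ → ℕ) → Clause → Clause
rename f = map (renameLit f)

module _ {f : ℕ → ℕ} where

  SatClause-rename⁻ : ∀ α C → SatClause α (rename f C) → SatClause (α ∘ f) C
  SatClause-rename⁻ α C = Any.map⁻

  ∈-rename⁻ : ∀ {x b C} → (x , b) ∈ rename f C → ∃[ y ] f y ≡ x × (y , b) ∈ C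
  ∈-rename⁻ x∈ with ∈-map⁻ (renameLit f) x∈
  ... | (y , b) , y∈ , refl = y , refl , y∈

  module _ (f-injective : Injective _≡_ _≡_ f) where

    renameLit-injective : Injective _≡_ _≡_ (renameLit f)
    renameLit-injective eq = cong₂ _,_ (f-injective (cong proj₁ eq)) (cong proj₂ eq)

    ∈-rename-injective⁻ : ∀ {a C} → renameLit f a ∈ rename f C → a ∈ C
    ∈-rename-injective⁻ {a} {C} fa∈ with ∈-map⁻ (renameLit f) fa∈
    ... | a′ , a′∈ , fa≡fa′ = subst (_∈ C) (sym (renameLit-injective fa≡fa′)) a′∈

    WFClause-rename : ∀ {C} → WFClause C → WFClause (rename f C)
    WFClause-rename (unique , consistent) =
      Unique.map⁺ renameLit-injective unique , complementary-free
      where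
      complementary-free : ∀ x → ¬ ((x , true) ∈ _ × (x , false) ∈ _)
      complementary-free x (pos , neg) with ∈-rename⁻ pos | ∈-rename⁻ neg
      ... | y , refl , y∈ | z , fz≡fy , z∈ =
        consistent y (y∈ , subst (λ w → (w , false) ∈ _) (f-injective fz≡fy) z∈)

    rename-⊆⁻ : ∀ {C D} → rename f C ⊆ rename f D → C ⊆ D
    rename-⊆⁻ fC⊆fD a∈C = ∈-rename-injective⁻ (fC⊆fD (∈-map⁺ (renameLit f) a∈C))

    Distinct-rename : ∀ {C D} → Distinct C D → Distinct (rename f C) (rename f D)
    Distinct-rename C≉D (fC⊆fD , fD⊆fC) = C≉D (rename-⊆⁻ fC⊆fD , rename-⊆⁻ fD⊆fC)

module Slots (K : ℕ) .{{_ : NonZero K}} where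

  slot : ℕ → ℕ → ℕ
  slot i y = i + y * K

  slot-% : ∀ {i} y → i < K → slot i y % K ≡ i
  slot-% {i} y i<K = trans ([m+kn]%n≡m%n i y K) (m<n⇒m%n≡m i<K)

  slot-/ : ∀ {i} y → i < K → slot i y / K ≡ y
  slot-/ {i} y i<K = begin
    (i + y * K) / K         ≡⟨ +-distrib-/ i (y * K) no-carry ⟩
    i / K + (y * K) / K     ≡⟨ cong₂ _+_ (m<n⇒m/n≡0 i<K) (m*n/n≡m y K) ⟩
    y                       ∎
    where
    open ≡-Reasoning
    no-carry : i % K + (y * K) % K < K
    no-carry = subst (_< K) (sym (trans (cong₂ _+_ (m<n⇒m%n≡m i<K) (m*n%n≡0 y K)) (+-identityʳ i))) i<K

  slot-injective₂ : ∀ {i j y z} → i < K → j < K → slot i y ≡ slot j z → i ≡ j × y ≡ z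
  slot-injective₂ {i} {j} {y} {z} i<K j<K eq =
    trans (sym (slot-% y i<K)) (trans (cong (_% K) eq) (slot-% z j<K)) ,
    trans (sym (slot-/ y i<K)) (trans (cong (_/ K) eq) (slot-/ z j<K))

  slot-injective : ∀ {i} → i < K → Injective _≡_ _≡_ (slot i)
  slot-injective i<K = proj₂ ∘ slot-injective₂ i<K i<K

  ∈-rename-slot⁻ : ∀ {i x b C} → i < K → (x , b) ∈ rename (slot i) C → i ≡ x % K × (x / K , b) ∈ C
  ∈-rename-slot⁻ {b = b} {C} i<K x∈ with ∈-rename⁻ x∈
  ... | y , refl , y∈ = sym (slot-% y i<K) , subst (λ w → (w , b) ∈ C) (sym (slot-/ y i<K)) y∈

  rename-slot-⊆⇒≡ : ∀ {i j a C D} → i < K → j < K → a ∈ C →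
                    rename (slot i) C ⊆ rename (slot j) D → i ≡ j
  rename-slot-⊆⇒≡ {i} {a = a} i<K j<K a∈C iC⊆jD =
    trans (sym (slot-% (proj₁ a) i<K)) (sym (proj₁ (∈-rename-slot⁻ j<K (iC⊆jD (∈-map⁺ (renameLit (slot i)) a∈C)))))

module BlowUp (n : ℕ) (l : Lit) (R : Formula) where

  K : ℕ
  K = suc n

  open Slots K

  copy : ℕ → Formula
  copy i = map (rename (slot i)) R

  copies : ℕ → Formula
  copies zero    = []
  copies (suc i) = copy i ++ copies i

  spread : Clause
  spread = map (λ i → renameLit (slot i) l) (upTo K)

  blowUp : Formula
  blowUp = spread ∷ copies K

  ∈-spread⁻ : ∀ {a} → a ∈ spread → ∃[ i ] i < K × a ≡ renameLit (slot i) l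
  ∈-spread⁻ a∈ with ∈-map⁻ _ a∈
  ... | i , i∈ , refl = i , ∈-upTo⁻ i∈ , refl

  ∈-spread-decode : ∀ {x b} → (x , b) ∈ spread → (x / K , b) ≡ l
  ∈-spread-decode x∈ with ∈-spread⁻ x∈
  ... | i , i<K , refl = cong (_, proj₂ l) (slot-/ (proj₁ l) i<K)

  All-copies⁻ : ∀ {P : Pred Clause 0ℓ} {i} j → i < j → All P (copies j) → All P (copy i)
  All-copies⁻ {i = i} (suc j) (s≤s i≤j) all with i ≟ j
  ... | yes refl = All.++⁻ˡ (copy j) all
  ... | no i≢j   = All-copies⁻ j (≤∧≢⇒< i≤j i≢j) (All.++⁻ʳ (copy j) all)

  All-copies⁺ : ∀ {P : Pred Clause 0ℓ} j → (∀ {i} → i < j → All P (copy i)) → All P (copies j)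
  All-copies⁺ zero    all = []
  All-copies⁺ (suc j) all = All.++⁺ (all ≤-refl) (All-copies⁺ j (all ∘ m≤n⇒m≤1+n))

  length-copies : ∀ j → length (copies j) ≡ j * length R
  length-copies zero    = refl
  length-copies (suc j) =
    trans (length-++ (copy j)) (cong₂ _+_ (length-map (rename (slot j)) R) (length-copies j))

  length-blowUp : length blowUp ≡ K * length R + 1
  length-blowUp = trans (cong suc (length-copies K)) (+-comm 1 _)

  blowUp-unsatisfiable : Unsatisfiable ([ l ] ∷ R) → Unsatisfiable blowUp
  blowUp-unsatisfiable unsat (α , satSpread ∷ satCopies) with find (Any.map⁻ satSpread)
  ... | i , i∈ , satLit =
    unsat (α ∘ slot i , here satLit ∷ All.map (SatClause-rename⁻ α _) (All.map⁻ satCopy))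
    where
    satCopy : All (SatClause α) (copy i)
    satCopy = All-copies⁻ K (∈-upTo⁻ i∈) satCopies

  WFClause-spread : WFClause spread
  WFClause-spread =
    Unique.map⁺ spread-injective (Unique.upTo⁺ K) ,
    λ x (pos , neg) → true≢false (trans (sign pos) (sym (sign neg)))
    where
    spread-injective : ∀ {i j} → renameLit (slot i) l ≡ renameLit (slot j) l → i ≡ j
    spread-injective {i} {j} eq = +-cancelʳ-≡ (proj₁ l * K) i j (cong proj₁ eq)
    sign : ∀ {x b} → (x , b) ∈ spread → b ≡ proj₂ l
    sign x∈ = cong proj₂ (∈-spread-decode x∈)
    true≢false : ¬ (true ≡ false)
    true≢false ()

  -- spread ≈ copy i of C would force C ≈ [ l ], which F already excludes.
  spread-Distinct-copy : ∀ {i C} → i < K → Distinct [ l ] C → Distinct spread (rename (slot i) C)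
  spread-Distinct-copy {i} {C} i<K l≉C (spread⊆iC , iC⊆spread) = l≉C (l⊆C , C⊆l)
    where
    l⊆C : [ l ] ⊆ C
    l⊆C (here refl) =
      ∈-rename-injective⁻ (slot-injective i<K) (spread⊆iC (∈-map⁺ _ (∈-upTo⁺ i<K)))
    C⊆l : C ⊆ [ l ]
    C⊆l {a} a∈C with ∈-spread⁻ (iC⊆spread (∈-map⁺ (renameLit (slot i)) a∈C))
    ... | j , j<K , eq with slot-injective₂ i<K j<K (cong proj₁ eq)
    ... | refl , var≡ = here (cong₂ _,_ var≡ (cong proj₂ eq))

  module _ (|R| : All (λ C → length C ≡ K) R) where

    blowUp-clause-lengths : All (λ C → length C ≡ K) blowUp
    blowUp-clause-lengths =
      trans (length-map _ (upTo K)) (length-upTo K) ∷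
      All-copies⁺ K (λ _ → All.map⁺ (All.map (λ {C} |C| → trans (length-map _ C) |C|) |R|))

    AllPairs-Distinct-copies : AllPairs Distinct R → ∀ j → j ≤ K → AllPairs Distinct (copies j)
    AllPairs-Distinct-copies distinct zero    _   = []
    AllPairs-Distinct-copies distinct (suc j) j<K =
      AllPairsₚ.++⁺
        (AllPairsₚ.map⁺ (AllPairs.map (Distinct-rename (slot-injective j<K)) distinct))
        (AllPairs-Distinct-copies distinct j (<⇒≤ j<K))
        (All.map⁺ (All.map later-copies-distinct |R|))
      where
      -- A non-empty clause of copy j has a variable of residue j, so it lies in no earlier copy.
      later-copies-distinct : ∀ {C} → length C ≡ K → All (Distinct (rename (slot j) C)) (copies j)
      later-copies-distinct {C} |C| with length≡suc⇒∃∈ |C|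
      ... | a , a∈C = All-copies⁺ j λ {i} i<j → All.map⁺ (All.universal (λ D (jC⊆iD , _) →
        <-irrefl (sym (rename-slot-⊆⇒≡ j<K (<-trans i<j j<K) a∈C jC⊆iD)) i<j) R)

    WFFormula-blowUp : WFFormula ([ l ] ∷ R) → WFFormula blowUp
    WFFormula-blowUp ((_ ∷ wfR) , (l≉R ∷ distinctR)) =
      (WFClause-spread ∷
        All-copies⁺ K (λ i<K → All.map⁺ (All.map (WFClause-rename (slot-injective i<K)) wfR))) ,
      (All-copies⁺ K (λ i<K → All.map⁺ (All.map (spread-Distinct-copy i<K) l≉R)) ∷
        AllPairs-Distinct-copies distinctR K ≤-refl)

  module Occurrences {P Q : Pred Clause 0ℓ} (P? : Decidable P) (Q? : Decidable Q) (i₀ : ℕ)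
    (P-copy : ∀ {i} C → i < K → P (rename (slot i) C) → i ≡ i₀ × Q C) where

    absent : ∀ {i} → ¬ (i ≡ i₀) → i < K → All (∁ P) (copy i)
    absent i≢i₀ i<K = All.map⁺ (All.universal (λ C → i≢i₀ ∘ proj₁ ∘ P-copy C i<K) R)

    count-copies-below : ∀ j → j ≤ i₀ → j ≤ K → count P? (copies j) ≡ 0
    count-copies-below zero    _    _   = refl
    count-copies-below (suc j) j<i₀ j<K = begin
      count P? (copy j ++ copies j)           ≡⟨ count-++ P? (copy j) (copies j) ⟩
      count P? (copy j) + count P? (copies j) ≡⟨ cong₂ _+_ (count-none P? (absent (<⇒≢ j<i₀) j<K))
                                                           (count-copies-below j (<⇒≤ j<i₀) (<⇒≤ j<K)) ⟩
      0                                       ∎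
      where open ≡-Reasoning

    count-copies : ∀ j → j ≤ K → count P? (copies j) ≤ count Q? R
    count-copies zero    _   = z≤n
    count-copies (suc j) j<K with j ≟ i₀
    ... | yes refl = begin
      count P? (copy j ++ copies j)           ≡⟨ count-++ P? (copy j) (copies j) ⟩
      count P? (copy j) + count P? (copies j) ≡⟨ cong (count P? (copy j) +_) (count-copies-below j ≤-refl (<⇒≤ j<K)) ⟩
      count P? (copy j) + 0                   ≡⟨ +-identityʳ _ ⟩
      count P? (copy j)                       ≤⟨ count-map-mono P? Q? (rename (slot j)) (λ C → proj₂ ∘ P-copy C j<K) R ⟩
      count Q? R                              ∎
      where open ≤-Reasoning
    ... | no j≢i₀ = begin
      count P? (copy j ++ copies j)           ≡⟨ count-++ P? (copy j) (copies j) ⟩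
      count P? (copy j) + count P? (copies j) ≡⟨ cong (_+ count P? (copies j)) (count-none P? (absent j≢i₀ j<K)) ⟩
      count P? (copies j)                     ≤⟨ count-copies j (<⇒≤ j<K) ⟩
      count Q? R                              ∎
      where open ≤-Reasoning

    count-blowUp : (P spread → Q [ l ]) → count P? blowUp ≤ count Q? ([ l ] ∷ R)
    count-blowUp P-spread = count-∷-mono P? Q? P-spread (count-copies K ≤-refl)

  blowUp-occurrences : OccurrenceBounded blowUp ([ l ] ∷ R)
  blowUp-occurrences x =
    x / K ,
    Occurrences.count-blowUp (occurs? x) (occurs? (x / K)) (x % K) occurs-copy occurs-spread ,
    Occurrences.count-blowUp ((x , true) ∈?_) ((x / K , true) ∈?_) (x % K)
      (λ C i<K → ∈-rename-slot⁻ i<K) (here ∘ ∈-spread-decode) ,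
    Occurrences.count-blowUp ((x , false) ∈?_) ((x / K , false) ∈?_) (x % K)
      (λ C i<K → ∈-rename-slot⁻ i<K) (here ∘ ∈-spread-decode)
    where
    Occurs : ℕ → Clause → Set
    Occurs y C = (y , true) ∈ C ⊎ (y , false) ∈ C
    occurs? : ∀ y → Decidable (Occurs y)
    occurs? y C = ((y , true) ∈? C) ⊎-dec ((y , false) ∈? C)
    occurs-copy : ∀ {i} C → i < K → Occurs x (rename (slot i) C) → i ≡ x % K × Occurs (x / K) C
    occurs-copy C i<K (inj₁ pos) = let i≡ , pos′ = ∈-rename-slot⁻ i<K pos in i≡ , inj₁ pos′
    occurs-copy C i<K (inj₂ neg) = let i≡ , neg′ = ∈-rename-slot⁻ i<K neg in i≡ , inj₂ neg′
    occurs-spread : Occurs x spread → Occurs (x / K) [ l ]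
    occurs-spread (inj₁ pos) = inj₁ (here (∈-spread-decode pos))
    occurs-spread (inj₂ neg) = inj₂ (here (∈-spread-decode neg))

length≡1⇒singleton : ∀ {A : Set} (xs : List A) → length xs ≡ 1 → ∃[ a ] xs ≡ [ a ]
length≡1⇒singleton (a ∷ []) refl = a , refl

stairway-unit : ∀ {n F} → HasStairwayKm1 (suc n) F →
                ∃[ l ] ∃[ R ] F ↭ [ l ] ∷ R × All (λ C → length C ≡ suc n) R
stairway-unit {n} (C , R , F↭ , |C| , |R|) with length≡1⇒singleton C (trans |C| (m+n∸n≡m 1 n))
... | l , refl = l , R , F↭ , |R|

blowUp-formula : ∀ n F → WFFormula F → HasStairwayKm1 (suc n) F → Unsatisfiable F →
  ∃[ G ] WFFormula G × All (λ C → length C ≡ suc n) G × Unsatisfiable G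
       × length G ≤ suc n * (length F ∸ 1) + 1 × OccurrenceBounded G F
blowUp-formula n F wf stairway unsat with stairway-unit stairway
... | l , R , F↭ , |R| =
  blowUp ,
  WFFormula-blowUp |R| (WFFormula-resp-↭ F↭ wf) ,
  blowUp-clause-lengths |R| ,
  blowUp-unsatisfiable (Unsatisfiable-resp-↭ F↭ unsat) ,
  ≤-reflexive (trans length-blowUp (cong (λ m → suc n * (m ∸ 1) + 1) (sym (↭-length F↭)))) ,
  OccurrenceBounded-resp-↭ {blowUp} (↭-sym F↭) blowUp-occurrences
  where open BlowUp n l R

module _ {G F : Formula} (bounded : OccurrenceBounded G F) where

  occ-bounded : ∀ {s} → (∀ y → occ y F ≤ s) → ∀ x → occ x G ≤ s
  occ-bounded occ≤s x = let y , occ≤ , _ = bounded x in ≤-trans occ≤ (occ≤s y)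

  posOcc-bounded : ∀ {p} → (∀ y → posOcc y F ≤ p) → ∀ x → posOcc x G ≤ p
  posOcc-bounded pos≤p x = let y , _ , pos≤ , _ = bounded x in ≤-trans pos≤ (pos≤p y)

  negOcc-bounded : ∀ {q} → (∀ y → negOcc y F ≤ q) → ∀ x → negOcc x G ≤ q
  negOcc-bounded neg≤q x = let y , _ , _ , neg≤ = bounded x in ≤-trans neg≤ (neg≤q y)

theorem7 : (∀ (k s : ℕ) → 1 ≤ k → 1 ≤ s →
    ∀ F → IsKS-Stair k s F → Unsatisfiable F →
    ∃[ G ] IsKS k s G × Unsatisfiable G × length G ≤ k * (length F ∸ 1) + 1)
    ×
    (∀ (k p q : ℕ) → 1 ≤ k → 1 ≤ p → 1 ≤ q →
    ∀ F → IsKPQ-Stair k p q F → Unsatisfiable F →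
    ∃[ G ] IsKPQ k p q G × Unsatisfiable G × length G ≤ k * (length F ∸ 1) + 1)
theorem7 =
  (λ { zero _ ()
     ; (suc n) _ _ _ F (wf , _ , occ≤s , stairway) unsat →
         let G , wfG , |G| , unsatG , size , bounded = blowUp-formula n F wf stairway unsat
         in G , (wfG , |G| , occ-bounded {G} {F} bounded occ≤s) , unsatG , size }) ,
  (λ { zero _ _ ()
     ; (suc n) _ _ _ _ _ F (wf , _ , pos≤p , neg≤q , stairway) unsat →
         let G , wfG , |G| , unsatG , size , bounded = blowUp-formula n F wf stairway unsat
         in G , (wfG , |G| , posOcc-bounded {G} {F} bounded pos≤p , negOcc-bounded {G} {F} bounded neg≤q) ,
            unsatG , size })
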